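{- Let $K\ge 1$, let $\mathcal{T}$ be a $K$-decomposition of a matroid $\mathcal{M}$ with rank function $r$, and let $v$ be a node of $\mathcal{T}$. Let $E_v$ be the set of elements of $\mathcal{M}$ assigned to the leaves of the subtree of $\mathcal{T}$ rooted at $v$, and $\overline{E_v}$ the set of the remaining elements. If $F_1$ and $F_2$ are two subsets of $E_v$ such that the color of $v$ (in the coloring procedure of the decomposition) is the same for $F_1$ and for $F_2$, then $$r(F)+r(F_1)-r(F\cup F_1)=r(F)+r(F_2)-r(F\cup F_2)$$ for every subset $F$ of $\overline{E_v}$.
   Context: Let $K\ge 1$ be an integer. A $K$-decomposition of a matroid $\mathcal{M}$ with ground set $E$ and rank function $r$ is a rooted tree $\mathcal{T}$ such that: the leaves of $\mathcal{T}$ are in one-to-one correspondence with $E$ and each leaf carries the information whether its element is a loop of $\mathcal{M}$; each inner node $v$ has exactly two (ordered) children and is equipped with functions $\varphi_v:\{0,\ldots,K\}^2\to\{0,\ldots,K\}$ and $\varphi_v^r:\{0,\ldots,K\}^2\to\mathbb{N}$. For $F\subseteq E$, the nodes are colored and labeled as follows: a leaf whose element lies in $F$ is colored $1$, other leaves are colored $0$; leaves colored $1$ whose element is not a loop are labeled $1$, all other leaves are labeled $0$; an inner node $v$ whose children have colors $\gamma_1,\gamma_2$ and labels $\lambda_1,\lambda_2$ is colored $\varphi_v(\gamma_1,\gamma_2)$ and labeled $\lambda_1+\lambda_2-\varphi_v^r(\gamma_1,\gamma_2)$. It is required that for every $F\subseteq E$ the label of the root equals $r(F)$, and that for $F=\emptyset$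 all nodes are colored $0$ and labeled $0$. The color of $v$ for a set $F\subseteq E_v$ is the color that $v$ receives when this procedure is run for $F$. -}

module Defs where

open import Data.Nat using (ℕ; zero; suc; _≤_)
open import Data.Nat as ℕ using ()
open import Data.Integer using (ℤ; +_; _+_; _-_)
open import Data.Fin using (Fin; zero; suc)
open import Data.Fin.Subset using (Subset; _∈_; _⊆_; _∪_; _∩_; ⊥; ⁅_⁆; ∁; ∣_∣)
open import Data.Fin.Subset.Properties using (_∈?_)
open import Data.Bool using (Bool; true; false; if_then_else_)
open import Data.Product using (_×_; _,_; proj₁; proj₂)
open import Data.List using (List; []; _∷_; _++_)
open import Data.List.Relation.Unary.Unique.Propositional using (Unique)
open import Data.List.Membership.Propositional using () renaming (_∈_ to _∈ₗ_)
open import Relation.Binary.PropositionalEquality using (_≡_)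
open import Relation.Nullary using (yes; no)
open import Function.Bundles using (_⇔_)

record Matroid (n : ℕ) : Set where
  field
    r         : Subset n → ℕ
    r-bounded : ∀ X → r X ≤ ∣ X ∣
    r-mono    : ∀ X Y → X ⊆ Y → r X ≤ r Y
    r-submod  : ∀ X Y → r (X ∪ Y) ℕ.+ r (X ∩ Y) ≤ r X ℕ.+ r Y

open Matroid public

IsLoop : ∀ {n} → Matroid n → Fin n → Set
IsLoop M e = r M ⁅ e ⁆ ≡ 0

-- Colors {0,…,K} are Fin (suc K).  We write K = suc k, so K ≥ 1.

Color : ℕ → Set
Color k = Fin (suc (suc k))

-- Rooted binary trees: leaves carry an element and a loop flag, inner
-- nodes carry φ_v and φ^r_v and two ordered children.
data Tree (k n : ℕ) : Set where
  leaf : Fin n → Bool → Tree k n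
  node : (Color k → Color k → Color k) → (Color k → Color k → ℕ) →
         Tree k n → Tree k n → Tree k n

leaves : ∀ {k n} → Tree k n → List (Fin n)
leaves (leaf e _)     = e ∷ []
leaves (node _ _ l r) = leaves l ++ leaves r

eval : ∀ {k n} → Tree k n → Subset n → Color k × ℤ
eval (leaf e b) F with e ∈? F
... | yes _ = suc zero , (if b then + 0 else + 1)
... | no  _ = zero , + 0
eval (node φ φr l r) F =
  let c₁ = proj₁ (eval l F) ; λ₁ = proj₂ (eval l F)
      c₂ = proj₁ (eval r F) ; λ₂ = proj₂ (eval r F)
  in φ c₁ c₂ , (λ₁ + λ₂) - (+ φr c₁ c₂)

color : ∀ {k n} → Tree k n → Subset n → Color k
color T F = proj₁ (eval T F)

label : ∀ {k n} → Tree k n → Subset n → ℤ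
label T F = proj₂ (eval T F)

AllZeroOnEmpty : ∀ {k n} → Tree k n → Set
AllZeroOnEmpty T@(leaf _ _)     = eval T ⊥ ≡ (zero , + 0)
AllZeroOnEmpty T@(node _ _ l r) =
  (eval T ⊥ ≡ (zero , + 0)) × AllZeroOnEmpty l × AllZeroOnEmpty r

LoopFlagsCorrect : ∀ {k n} → Matroid n → Tree k n → Set
LoopFlagsCorrect M (leaf e b)     = (b ≡ true) ⇔ IsLoop M e
LoopFlagsCorrect M (node _ _ l r) = LoopFlagsCorrect M l × LoopFlagsCorrect M r

record IsDecomposition {k n} (M : Matroid n) (T : Tree k n) : Set where
  field
    leaves-unique   : Unique (leaves T)
    leaves-complete : ∀ e → e ∈ₗ leaves T
    loops-correct   : LoopFlagsCorrect M T
    root-rank       : ∀ F → label T F ≡ + (r M F)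
    empty-zero      : AllZeroOnEmpty T

data _IsNodeOf_ {k n} : Tree k n → Tree k n → Set where
  here  : ∀ {T} → T IsNodeOf T
  left  : ∀ {v φ φr l r} → v IsNodeOf l → v IsNodeOf node φ φr l r
  right : ∀ {v φ φr l r} → v IsNodeOf r → v IsNodeOf node φ φr l r

_⊆E_ : ∀ {k n} → Subset n → Tree k n → Set
F ⊆E v = ∀ {e} → e ∈ F → e ∈ₗ leaves v

_⊆Ē_ : ∀ {k n} → Subset n → Tree k n → Set
F ⊆Ē v = ∀ {e} → e ∈ F → e ∈ₗ leaves v → Data.Empty.⊥
  where import Data.Empty

-- A decomposition tree computes the label of its root by a bottom-up recursion, and the
-- part of that computation above a node v sees the subtree at v only through the color
-- and the label of v.  Hence, for sets G and G' that agree outside E_v and give v the same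
-- color, the label of the root minus the label of v is the same for G and G'.  Applying
-- this to the pairs (F₁, F₂) and (F ∪ F₁, F ∪ F₂), and using that v does not see F,
-- both r(Fᵢ) and r(F ∪ Fᵢ) are the same shift of the label of v on Fᵢ, so the label of v
-- cancels from r(F) + r(Fᵢ) − r(F ∪ Fᵢ).
module Submission where

open import Defs
open import Data.Integer using (ℤ; +_; _+_; _-_)
open import Data.Integer.Properties using (+-inverseʳ)
open import Data.Integer.Solver using (module +-*-Solver)
open import Data.Fin using (Fin)
open import Data.Fin.Subset using (Subset; _∪_; _∈_)
open import Data.Fin.Subset.Properties using (_∈?_; x∈p∪q⁺; x∈p∪q⁻)
open import Data.Product using (_×_; _,_; proj₁; proj₂)
open import Data.Sum using (inj₁; inj₂; [_,_])
open import Data.Empty using (⊥-elim)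
open import Data.List using (List; []; _∷_; _++_)
open import Data.List.Relation.Unary.Any using (here; there)
open import Data.List.Relation.Unary.All using (lookup)
open import Data.List.Relation.Unary.All.Properties using (++⁻ˡ; ++⁻ʳ)
open import Data.List.Relation.Unary.AllPairs using ([]; _∷_)
open import Data.List.Relation.Unary.Unique.Propositional using (Unique)
open import Data.List.Relation.Binary.Disjoint.Propositional using (Disjoint)
open import Data.List.Membership.Propositional using () renaming (_∈_ to _∈ₗ_)
open import Data.List.Membership.Propositional.Properties using (∈-++⁺ˡ; ∈-++⁺ʳ)
open import Function.Bundles using (_⇔_; mk⇔; Equivalence)
open import Relation.Nullary using (¬_; yes; no)
open import Relation.Binary.PropositionalEquality
  using (_≡_; refl; sym; cong; cong₂; subst₂; module ≡-Reasoning)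

open Equivalence using (to; from)

unique-++⁻ : ∀ {A : Set} (xs : List A) {ys : List A} →
             Unique (xs ++ ys) → Unique xs × Unique ys × Disjoint xs ys
unique-++⁻ []       u = [] , u , λ { (() , _) }
unique-++⁻ (x ∷ xs) (x∉ ∷ u) with unique-++⁻ xs u
... | uxs , uys , xs#ys = ++⁻ˡ xs x∉ ∷ uxs , uys , x∷xs#ys
  where
  x∷xs#ys : Disjoint (x ∷ xs) _
  x∷xs#ys (here refl , y) = lookup (++⁻ʳ xs x∉) y refl
  x∷xs#ys (there p   , y) = xs#ys (p , y)

IsNodeOf⇒leaves⊆ : ∀ {k n} {v T : Tree k n} → v IsNodeOf T →
                   ∀ {e} → e ∈ₗ leaves v → e ∈ₗ leaves T
IsNodeOf⇒leaves⊆ here                 e∈v = e∈v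
IsNodeOf⇒leaves⊆ (left v∈l)           e∈v = ∈-++⁺ˡ (IsNodeOf⇒leaves⊆ v∈l e∈v)
IsNodeOf⇒leaves⊆ (right {l = l} v∈r) e∈v = ∈-++⁺ʳ (leaves l) (IsNodeOf⇒leaves⊆ v∈r e∈v)

infix 4 _≐_on_

_≐_on_ : ∀ {n} → Subset n → Subset n → (Fin n → Set) → Set
G ≐ G′ on P = ∀ {e} → P e → (e ∈ G ⇔ e ∈ G′)

Outside : ∀ {k n} → Tree k n → Fin n → Set
Outside v e = ¬ e ∈ₗ leaves v

≐-on-complement : ∀ {n} {P : Fin n → Set} {G G′ : Subset n} →
                  (∀ {e} → e ∈ G → P e) → (∀ {e} → e ∈ G′ → P e) →
                  G ≐ G′ on (λ e → ¬ P e)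
≐-on-complement G⊆P G′⊆P ¬P = mk⇔ (λ e∈G → ⊥-elim (¬P (G⊆P e∈G)))
                                   (λ e∈G′ → ⊥-elim (¬P (G′⊆P e∈G′)))

∪-congˡ-≐ : ∀ {n} {P : Fin n → Set} (X : Subset n) {G G′ : Subset n} →
            G ≐ G′ on P → X ∪ G ≐ X ∪ G′ on P
∪-congˡ-≐ X {G} {G′} G≐G′ p = mk⇔
  (λ e∈X∪G → [ (λ e∈X → x∈p∪q⁺ (inj₁ e∈X)) , (λ e∈G → x∈p∪q⁺ (inj₂ (to (G≐G′ p) e∈G))) ]
               (x∈p∪q⁻ X G e∈X∪G))
  (λ e∈X∪G′ → [ (λ e∈X → x∈p∪q⁺ (inj₁ e∈X)) , (λ e∈G′ → x∈p∪q⁺ (inj₂ (from (G≐G′ p) e∈G′))) ]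
               (x∈p∪q⁻ X G′ e∈X∪G′))

∪-identityˡ-≐ : ∀ {n} {P : Fin n → Set} {X : Subset n} (G : Subset n) →
                (∀ {e} → e ∈ X → ¬ P e) → X ∪ G ≐ G on P
∪-identityˡ-≐ {X = X} G X∩P=∅ p = mk⇔
  (λ e∈X∪G → [ (λ e∈X → ⊥-elim (X∩P=∅ e∈X p)) , (λ e∈G → e∈G) ] (x∈p∪q⁻ X G e∈X∪G))
  (λ e∈G → x∈p∪q⁺ (inj₂ e∈G))

eval-local : ∀ {k n} (t : Tree k n) {G G′ : Subset n} →
             G ≐ G′ on (_∈ₗ leaves t) → eval t G ≡ eval t G′
eval-local (leaf e b) {G} {G′} G≐G′ with e ∈? G | e ∈? G′
... | yes _    | yes _     = refl
... | no  _    | no  _     = refl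
... | yes e∈G  | no  e∉G′ = ⊥-elim (e∉G′ (to (G≐G′ (here refl)) e∈G))
... | no  e∉G  | yes e∈G′ = ⊥-elim (e∉G (from (G≐G′ (here refl)) e∈G′))
eval-local (node φ φr l r) G≐G′
  rewrite eval-local l (λ e∈l → G≐G′ (∈-++⁺ˡ e∈l))
        | eval-local r (λ e∈r → G≐G′ (∈-++⁺ʳ (leaves l) e∈r)) = refl

module _ where
  open +-*-Solver

  shiftˡ : ∀ (a b c d : ℤ) → a + b - c - d ≡ (a - d) + b - c
  shiftˡ = solve 4 (λ a b c d → a :+ b :- c :- d := (a :- d) :+ b :- c) refl

  shiftʳ : ∀ (a b c d : ℤ) → a + b - c - d ≡ a + (b - d) - c
  shiftʳ = solve 4 (λ a b c d → a :+ b :- c :- d := a :+ (b :- d) :- c) refl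

  shift-cancel : ∀ (a b c d : ℤ) → a + b - c ≡ a + (b - d) - (c - d)
  shift-cancel = solve 4 (λ a b c d → a :+ b :- c := a :+ (b :- d) :- (c :- d)) refl

-- At each step down to v, the sibling subtree lies outside v by uniqueness of the leaves.
subtree-replacement :
  ∀ {k n} {T v : Tree k n} → v IsNodeOf T → Unique (leaves T) →
  {G G′ : Subset n} → G ≐ G′ on Outside v → color v G ≡ color v G′ →
  color T G ≡ color T G′ × label T G - label v G ≡ label T G′ - label v G′
subtree-replacement {T = T} here _ {G} {G′} _ same-color =
  same-color , (begin
    label T G - label T G   ≡⟨ +-inverseʳ (label T G) ⟩
    + 0                     ≡⟨ sym (+-inverseʳ (label T G′)) ⟩
    label T G′ - label T G′ ∎)
  where open ≡-Reasoning
subtree-replacement {v = v} (left {φ = φ} {φr} {l} {r} v∈l) u {G} {G′} G≐G′ same-color =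
  cong₂ φ same-colorˡ (cong proj₁ same-evalʳ) , (begin
    label l G + label r G - + φr (color l G) (color r G) - label v G
      ≡⟨ shiftˡ (label l G) (label r G) _ (label v G) ⟩
    (label l G - label v G) + label r G - + φr (color l G) (color r G)
      ≡⟨ cong (λ d → d + label r G - + φr (color l G) (color r G)) same-shiftˡ ⟩
    (label l G′ - label v G′) + label r G - + φr (color l G) (color r G)
      ≡⟨ cong₂ (λ c e → (label l G′ - label v G′) + proj₂ e - + φr c (proj₁ e))
               same-colorˡ same-evalʳ ⟩
    (label l G′ - label v G′) + label r G′ - + φr (color l G′) (color r G′)
      ≡⟨ sym (shiftˡ (label l G′) (label r G′) _ (label v G′)) ⟩
    label l G′ + label r G′ - + φr (color l G′) (color r G′) - label v G′ ∎)
  where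
  open ≡-Reasoning
  split : Unique (leaves l) × Unique (leaves r) × Disjoint (leaves l) (leaves r)
  split = unique-++⁻ (leaves l) u
  same-evalʳ : eval r G ≡ eval r G′
  same-evalʳ = eval-local r λ e∈r →
    G≐G′ (λ e∈v → proj₂ (proj₂ split) (IsNodeOf⇒leaves⊆ v∈l e∈v , e∈r))
  IH : color l G ≡ color l G′ × label l G - label v G ≡ label l G′ - label v G′
  IH = subtree-replacement v∈l (proj₁ split) G≐G′ same-color
  same-colorˡ : color l G ≡ color l G′
  same-colorˡ = proj₁ IH
  same-shiftˡ : label l G - label v G ≡ label l G′ - label v G′
  same-shiftˡ = proj₂ IH
subtree-replacement {v = v} (right {φ = φ} {φr} {l} {r} v∈r) u {G} {G′} G≐G′ same-color =
  cong₂ φ (cong proj₁ same-evalˡ) same-colorʳ , (begin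
    label l G + label r G - + φr (color l G) (color r G) - label v G
      ≡⟨ shiftʳ (label l G) (label r G) _ (label v G) ⟩
    label l G + (label r G - label v G) - + φr (color l G) (color r G)
      ≡⟨ cong (λ d → label l G + d - + φr (color l G) (color r G)) same-shiftʳ ⟩
    label l G + (label r G′ - label v G′) - + φr (color l G) (color r G)
      ≡⟨ cong₂ (λ e c → proj₂ e + (label r G′ - label v G′) - + φr (proj₁ e) c)
               same-evalˡ same-colorʳ ⟩
    label l G′ + (label r G′ - label v G′) - + φr (color l G′) (color r G′)
      ≡⟨ sym (shiftʳ (label l G′) (label r G′) _ (label v G′)) ⟩
    label l G′ + label r G′ - + φr (color l G′) (color r G′) - label v G′ ∎)
  where
  open ≡-Reasoning
  split : Unique (leaves l) × Unique (leaves r) × Disjoint (leaves l) (leaves r)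
  split = unique-++⁻ (leaves l) u
  same-evalˡ : eval l G ≡ eval l G′
  same-evalˡ = eval-local l λ e∈l →
    G≐G′ (λ e∈v → proj₂ (proj₂ split) (e∈l , IsNodeOf⇒leaves⊆ v∈r e∈v))
  IH : color r G ≡ color r G′ × label r G - label v G ≡ label r G′ - label v G′
  IH = subtree-replacement v∈r (proj₁ (proj₂ split)) G≐G′ same-color
  same-colorʳ : color r G ≡ color r G′
  same-colorʳ = proj₁ IH
  same-shiftʳ : label r G - label v G ≡ label r G′ - label v G′
  same-shiftʳ = proj₂ IH

rank-minus-label-invariant :
  ∀ {k n} {M : Matroid n} {T v : Tree k n} → IsDecomposition M T → v IsNodeOf T →
  {G G′ : Subset n} → G ≐ G′ on Outside v → color v G ≡ color v G′ →
  + r M G - label v G ≡ + r M G′ - label v G′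
rank-minus-label-invariant {v = v} D v∈T {G} {G′} G≐G′ same-color =
  subst₂ (λ ρ ρ′ → ρ - label v G ≡ ρ′ - label v G′) (root-rank G) (root-rank G′)
         (proj₂ (subtree-replacement v∈T leaves-unique G≐G′ same-color))
  where open IsDecomposition D

lemma6 : ∀ {k n} (M : Matroid n) (T : Tree k n) → IsDecomposition M T →
         (v : Tree k n) → v IsNodeOf T →
         (F₁ F₂ : Subset n) → F₁ ⊆E v → F₂ ⊆E v →
         color v F₁ ≡ color v F₂ →
         (F : Subset n) → F ⊆Ē v →
         (+ r M F) + (+ r M F₁) - (+ r M (F ∪ F₁))
           ≡ (+ r M F) + (+ r M F₂) - (+ r M (F ∪ F₂))
lemma6 M T D v v∈T F₁ F₂ F₁⊆v F₂⊆v same-color F F∩v=∅ = begin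
  ρ F + ρ F₁ - ρ (F ∪ F₁)
    ≡⟨ shift-cancel (ρ F) (ρ F₁) (ρ (F ∪ F₁)) (label v F₁) ⟩
  ρ F + (ρ F₁ - label v F₁) - (ρ (F ∪ F₁) - label v F₁)
    ≡⟨ cong₂ (λ a b → ρ F + a - b) shift₁₂ shift∪ ⟩
  ρ F + (ρ F₂ - label v F₂) - (ρ (F ∪ F₂) - label v F₂)
    ≡⟨ sym (shift-cancel (ρ F) (ρ F₂) (ρ (F ∪ F₂)) (label v F₂)) ⟩
  ρ F + ρ F₂ - ρ (F ∪ F₂) ∎
  where
  open ≡-Reasoning
  ρ : Subset _ → ℤ
  ρ X = + r M X
  v-ignores-F : ∀ X → eval v (F ∪ X) ≡ eval v X
  v-ignores-F X = eval-local v (∪-identityˡ-≐ X F∩v=∅)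
  F₁≐F₂ : F₁ ≐ F₂ on Outside v
  F₁≐F₂ = ≐-on-complement F₁⊆v F₂⊆v
  shift₁₂ : ρ F₁ - label v F₁ ≡ ρ F₂ - label v F₂
  shift₁₂ = rank-minus-label-invariant D v∈T F₁≐F₂ same-color
  shift∪ : ρ (F ∪ F₁) - label v F₁ ≡ ρ (F ∪ F₂) - label v F₂
  shift∪ = subst₂ (λ λ₁ λ₂ → ρ (F ∪ F₁) - λ₁ ≡ ρ (F ∪ F₂) - λ₂)
             (cong proj₂ (v-ignores-F F₁)) (cong proj₂ (v-ignores-F F₂))
             (rank-minus-label-invariant D v∈T (∪-congˡ-≐ F F₁≐F₂) same-color∪)
    where
    same-color∪ : color v (F ∪ F₁) ≡ color v (F ∪ F₂)
    same-color∪ = subst₂ _≡_ (sym (cong proj₁ (v-ignores-F F₁)))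
                             (sym (cong proj₁ (v-ignores-F F₂))) same-color
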